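{- Let $G$ be a graph with $h_1(G)=1$, and let $C_n$ be its unique cycle. Then either $\overline G$ is simple or $c(\overline G)=\{\overline{C_n}\}$.
   Context: $h_1(G)=\kappa+|E|-|V|$ with $\kappa$ the number of connected components, so $G$ contains exactly one cycle. For a graph on vertex set $X=\{x_1,\ldots,x_n\}$ the edge ideal $\overline G\subset\mathbb{Z}[X]$ is generated by the $x_i^2$ and by $x_ix_j$ for edges $\{x_i,x_j\}$; an ideal $I\subset\mathbb{Z}[Y]$ is identified with $(I,a)\subset\mathbb{Z}[Y\cup\{a\}]$ for extra variables $a$ (so $\overline{C_n}$ is regarded as an ideal of $\mathbb{Z}[X]$ containing the vertices not on the cycle). For a monomial ideal $I$ containing all squares of variables: $R(I)$ is the complex of monomials not in $I$; $(I:x)=\{m:xm\in I\}$; $R(I)$ is a cone with apex $a$ if $(I:a)=(I,a)$; $a$ dominates $b$ in $I$ if $R(I)$ is not a cone with apex $b$ but $R((I,a))$ is. A sequence $(a_1,\ldots,a_r)$ of variables with $I_i=(I:a_1\cdots a_{i-1})$, $i\in[r+1]$, is a resolution if for all $i\in[r]$, $a_i\notin I_i$ and either $R(I_i)$ is a cone with apex $a_i$ or $a_i$ dominates some variable in $I_i$; it is maximal if not extendable; its core is $I_{r+1}$; $c(I)$ is the set of cores of maximal resolutions; $I$ is simple if $(x_1,\ldots,x_n)\in c(I)$. -}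

module Defs where

open import Data.Nat using (ℕ; zero; suc; _+_; _<ᵇ_)
open import Data.Bool using (Bool; true; false; _∧_; if_then_else_)
open import Data.Fin using (Fin; zero; suc; toℕ; inject₁; fromℕ)
open import Data.Fin.Subset using (Subset; _∈_; _∪_; ⁅_⁆)
open import Data.List using (List; []; _∷_; _++_; [_]; map; concatMap; allFin)
open import Data.Nat.ListAction using (sum)
open import Data.Product using (Σ; _×_; _,_; ∃; ∃-syntax)
open import Data.Sum using (_⊎_)
open import Data.Unit using (⊤)
open import Data.Empty using (⊥)
open import Relation.Nullary using (¬_)
open import Relation.Binary.PropositionalEquality using (_≡_)
open import Function.Definitions using (Surjective; Injective)

-- Finite simple graphs on the vertex set X = {x_0,…,x_{n-1}} ≅ Fin n

record Graph (n : ℕ) : Set where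
  field
    adj   : Fin n → Fin n → Bool
    sym   : ∀ u v → adj u v ≡ adj v u
    irrefl : ∀ u → adj u u ≡ false
open Graph public

Adj : ∀ {n} → Graph n → Fin n → Fin n → Set
Adj G u v = adj G u v ≡ true

edgeCount : ∀ {n} → Graph n → ℕ
edgeCount {n} G =
  sum (concatMap (λ u → map (λ v → if (toℕ u <ᵇ toℕ v) ∧ adj G u v then 1 else 0)
                            (allFin n))
                 (allFin n))

data Connected {n : ℕ} (G : Graph n) : Fin n → Fin n → Set where
  here : ∀ {u} → Connected G u u
  step : ∀ {u v w} → Adj G u v → Connected G v w → Connected G u w

HasComponents : ∀ {n} → Graph n → ℕ → Set
HasComponents {n} G k =
  Σ (Fin n → Fin k) λ c →
    Surjective _≡_ _≡_ c ×
    (∀ u v → (c u ≡ c v → Connected G u v) × (Connected G u v → c u ≡ c v))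

-- h₁(G) = κ + |E| - |V| = 1
H1isOne : ∀ {n} → Graph n → Set
H1isOne {n} G = Σ ℕ λ κ → HasComponents G κ × (κ + edgeCount G ≡ n + 1)

-- A cycle in G of length m+3: injective vertex map with consecutive
-- vertices (cyclically) adjacent.
record Cycle {n : ℕ} (G : Graph n) : Set where
  field
    m      : ℕ
    vtx    : Fin (suc (suc (suc m))) → Fin n
    inj    : Injective _≡_ _≡_ vtx
    edges  : ∀ (i : Fin (suc (suc m))) → Adj G (vtx (inject₁ i)) (vtx (suc i))
    closing : Adj G (vtx (fromℕ (suc (suc m)))) (vtx zero)
open Cycle public

CycStep : ∀ {n} {G : Graph n} → Cycle G → Fin n → Fin n → Set
CycStep C u v =
  (Σ (Fin (suc (suc (m C)))) λ i → (vtx C (inject₁ i) ≡ u) × (vtx C (suc i) ≡ v))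
  ⊎ ((vtx C (fromℕ (suc (suc (m C)))) ≡ u) × (vtx C zero ≡ v))

CycEdge : ∀ {n} {G : Graph n} → Cycle G → Fin n → Fin n → Set
CycEdge C u v = CycStep C u v ⊎ CycStep C v u

OnCycle : ∀ {n} {G : Graph n} → Cycle G → Fin n → Set
OnCycle C u = Σ _ λ i → vtx C i ≡ u

-- Monomial ideals of ℤ[X] containing all squares x_i².
-- Such an ideal is determined by the squarefree monomials it contains;
-- a squarefree monomial is a subset S ⊆ X.  We represent the ideal by
-- the predicate "S ∈ I" on subsets.

Ideal : ℕ → Set₁
Ideal n = Subset n → Set

_≐_ : ∀ {n} → Ideal n → Ideal n → Set
I ≐ J = ∀ S → (I S → J S) × (J S → I S)

VarIn : ∀ {n} → Ideal n → Fin n → Set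
VarIn I x = I ⁅ x ⁆

-- (I : x) = {m : x m ∈ I}; if x ∈ S then x·S is not squarefree, hence in I
colon : ∀ {n} → Ideal n → Fin n → Ideal n
colon I x S = (x ∈ S) ⊎ I (⁅ x ⁆ ∪ S)

addVar : ∀ {n} → Ideal n → Fin n → Ideal n
addVar I x S = (x ∈ S) ⊎ I S

-- R(I) is a cone with apex a  iff  (I : a) = (I , a)
IsCone : ∀ {n} → Ideal n → Fin n → Set
IsCone I a = colon I a ≐ addVar I a

Dominates : ∀ {n} → Ideal n → Fin n → Fin n → Set
Dominates I a b = ¬ IsCone I b × IsCone (addVar I a) b

IsResolution : ∀ {n} → Ideal n → List (Fin n) → Set
IsResolution I [] = ⊤
IsResolution I (a ∷ as) =
  ¬ VarIn I a × (IsCone I a ⊎ (∃[ b ] Dominates I a b)) × IsResolution (colon I a) as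

core : ∀ {n} → Ideal n → List (Fin n) → Ideal n
core I [] = I
core I (a ∷ as) = core (colon I a) as

IsMaximalResolution : ∀ {n} → Ideal n → List (Fin n) → Set
IsMaximalResolution I as =
  IsResolution I as × (¬ (∃[ a ] IsResolution I (as ++ [ a ])))

InCores : ∀ {n} → Ideal n → Ideal n → Set
InCores I J = ∃[ as ] (IsMaximalResolution I as × (core I as ≐ J))

CoresSingleton : ∀ {n} → Ideal n → Ideal n → Set₁
CoresSingleton I J = InCores I J × (∀ J' → InCores I J' → J' ≐ J)

-- the maximal ideal (x₁,…,x_n): squarefree monomials ≠ 1
maxIdeal : ∀ {n} → Ideal n
maxIdeal S = ∃[ x ] (x ∈ S)

IsSimple : ∀ {n} → Ideal n → Set
IsSimple I = InCores I maxIdeal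

edgeIdeal : ∀ {n} → Graph n → Ideal n
edgeIdeal G S = ∃[ u ] ∃[ v ] (Adj G u v × u ∈ S × v ∈ S)

-- C̄ regarded in ℤ[X]: squares, cycle edges, and the vertices off the cycle
cycleIdeal : ∀ {n} {G : Graph n} → Cycle G → Ideal n
cycleIdeal C S =
  (∃[ u ] (u ∈ S × ¬ OnCycle C u))
  ⊎ (∃[ u ] ∃[ v ] (CycEdge C u v × u ∈ S × v ∈ S))

{-# OPTIONS --safe #-}
-- Every ideal met along a resolution of Ḡ has the form (Ḡ, R) for a set R of vertices: the colon by
-- a vertex a ∉ R adds a and its neighbours to R.  The ideal (Ḡ, R) is a cone with apex b iff b is an
-- isolated vertex of G − R, and a dominates b iff a is the only neighbour of b outside R.  Hence, when
-- no further step is possible, every vertex outside R has at least two neighbours outside R.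
--
-- If R contains every vertex, the core is the maximal ideal.  Otherwise the vertices outside R span a
-- subgraph of minimum degree two, and this subgraph is the cycle C: deleting an edge of C leaves a
-- forest, since κ + |E| ≥ |V| in every graph, and in a forest a walk that never turns back can only
-- stop at an end of the deleted edge, so a vertex off C would lie on a second cycle.  The core is then
-- C̄.  The resolutions form a finite tree, so it is decidable whether some maximal resolution ends in
-- the maximal ideal; if none does, every core is C̄.
module Submission where

open import Defs
open import Data.Bool using (Bool; true; false; _∧_; not; if_then_else_; T)
import Data.Bool as Bool
open import Data.Bool.Properties using (∧-comm; ∧-identityʳ; ∧-conicalˡ; ∧-conicalʳ; T-≡)
open import Data.Empty using (⊥; ⊥-elim)
open import Data.Fin using (Fin; zero; suc; toℕ; inject₁; fromℕ; _≟_)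
import Data.Fin.Properties as Fin
open import Data.Fin.Properties
  using (any?; all?; ¬∀⟶∃¬; toℕ-injective; inject₁-injective; fromℕ≢inject₁; injective⇒≤; ≤fromℕ)
open import Data.List using (List; []; _∷_; _++_; [_]; map; concatMap; allFin; tabulate)
open import Data.List.Properties using (tabulate-cong; map-tabulate)
open import Data.Nat using (ℕ; zero; suc; _+_; _<_; _≮_; _<ᵇ_)
open import Data.Nat.ListAction using (sum)
open import Data.Nat.ListAction.Properties using (sum-++)
open import Data.Nat.Properties
  using (<-cmp; <-asym; <ᵇ⇒<; <⇒<ᵇ; <⇒≱; ≤-trans; ≤-reflexive; ≤-<-trans; m≤m+n; n≤1+n; +-suc; +-comm;
         +-monoʳ-≤; suc-injective)
open import Data.Product using (Σ; _×_; _,_; ∃-syntax; proj₁; proj₂)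
import Data.Product as Prod
open import Data.Sum using (_⊎_; inj₁; inj₂; [_,_]′)
import Data.Sum as Sum
open import Function using (_∘_; id)
open import Relation.Binary.Definitions using (tri<; tri≈; tri>)
open import Relation.Binary.PropositionalEquality
  using (_≡_; _≢_; refl; trans; cong; cong₂; subst; module ≡-Reasoning)
import Relation.Binary.PropositionalEquality as ≡
open import Relation.Nullary using (¬_; Dec; yes; no; does; contradiction)
open import Relation.Nullary.Decidable
  using (_×-dec_; _⊎-dec_; _→-dec_; ¬?; map′; dec-true; dec-false; does-⇔; decidable-stable;
         ¬¬-excluded-middle)
open import Function.Bundles using (Equivalence; mk⇔)
open import Data.Fin.Subset using (Subset; _∈_; _∉_; _⊆_; _⊂_; _⊃_; _∪_; _∩_; ∁; ⁅_⁆)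
  renaming (⊥ to ∅)
open import Data.Fin.Subset.Properties
  using (_∈?_; x∈⁅x⁆; x∈⁅y⁆⇒x≡y; x≢y⇒x∉⁅y⁆; x∉⁅y⁆⇒x≢y; x∈p∪q⁺; x∈p∪q⁻; p⊆p∪q; x∈p∩q⁺; x∈p∩q⁻;
         x∉p⇒x∈∁p; x∈∁p⇒x∉p; ∉⊥)
import Data.Vec as Vec
open import Data.Vec.Properties using (lookup∘tabulate; []=⇒lookup; lookup⇒[]=)
open import Data.Unit using (tt)
open import Data.Fin.Subset.Induction using (Acc; acc; ⊃-wellFounded)
open import Data.Fin.Induction using (<-weakInduction; <-weakInduction-startingFrom)
open import Relation.Unary using (Decidable)

does⇒ : ∀ {P : Set} (P? : Dec P) → does P? ≡ true → P
does⇒ (yes p) _ = p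

∑ : ∀ {k} → (Fin k → ℕ) → ℕ
∑ f = sum (tabulate f)

∑-cong : ∀ {k} {f g : Fin k → ℕ} → (∀ i → f i ≡ g i) → ∑ f ≡ ∑ g
∑-cong f≗g = cong sum (tabulate-cong f≗g)

∑-suc-at : ∀ {k} (f g : Fin k → ℕ) i → (∀ j → j ≢ i → f j ≡ g j) → f i ≡ suc (g i) →
           ∑ f ≡ suc (∑ g)
∑-suc-at f g zero off at = cong₂ _+_ at (∑-cong (λ j → off (suc j) λ ()))
∑-suc-at f g (suc i) off at =
  trans (cong₂ _+_ (off zero λ ())
                   (∑-suc-at (f ∘ suc) (g ∘ suc) i (λ j j≢i → off (suc j) (j≢i ∘ Fin.suc-injective)) at))
        (+-suc (g zero) (∑ (g ∘ suc)))

∑∑-suc-at : ∀ {k l} (f g : Fin k → Fin l → ℕ) i j →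
            (∀ i′ j′ → ¬ (i′ ≡ i × j′ ≡ j) → f i′ j′ ≡ g i′ j′) → f i j ≡ suc (g i j) →
            ∑ (∑ ∘ f) ≡ suc (∑ (∑ ∘ g))
∑∑-suc-at f g i j off at =
  ∑-suc-at (∑ ∘ f) (∑ ∘ g) i
    (λ i′ i′≢i → ∑-cong (λ j′ → off i′ j′ (i′≢i ∘ proj₁)))
    (∑-suc-at (f i) (g i) j (λ j′ j′≢j → off i j′ (j′≢j ∘ proj₂)) at)

sum-concatMap : ∀ {A : Set} (g : A → List ℕ) xs → sum (concatMap g xs) ≡ sum (map (sum ∘ g) xs)
sum-concatMap g [] = refl
sum-concatMap g (x ∷ xs) = trans (sum-++ (g x) (concatMap g xs)) (cong (sum (g x) +_) (sum-concatMap g xs))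

sum-map-allFin : ∀ {k} (f : Fin k → ℕ) → sum (map f (allFin k)) ≡ ∑ f
sum-map-allFin f = cong sum (map-tabulate (λ i → i) f)

<⇒>ᵇ≡false : ∀ {m n} → m < n → (n <ᵇ m) ≡ false
<⇒>ᵇ≡false {m} {n} m<n with n <ᵇ m in eq
... | false = refl
... | true = contradiction (<ᵇ⇒< n m (subst T (≡.sym eq) _)) (<-asym m<n)

<⇒<ᵇ≡true : ∀ {m n} → m < n → (m <ᵇ n) ≡ true
<⇒<ᵇ≡true = Equivalence.to T-≡ ∘ <⇒<ᵇ

module _ {n : ℕ} where

  infix 4 _⊑_
  _⊑_ : Graph n → Graph n → Set
  H ⊑ H′ = ∀ {u v} → Adj H u v → Adj H′ u v

  Adj-sym : ∀ H {u v : Fin n} → Adj H u v → Adj H v u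
  Adj-sym H {u} {v} = trans (sym H v u)

  Adj-irrefl : ∀ H {u v : Fin n} → Adj H u v → u ≢ v
  Adj-irrefl H {u} a refl = contradiction (trans (≡.sym (irrefl H u)) a) λ ()

  Connected-trans : ∀ {H : Graph n} {x y z} → Connected H x y → Connected H y z → Connected H x z
  Connected-trans here q = q
  Connected-trans (step a p) q = step a (Connected-trans p q)

  Adj⇒Connected : ∀ {H : Graph n} {x y} → Adj H x y → Connected H x y
  Adj⇒Connected a = step a here

  Connected-sym : ∀ {H : Graph n} {x y} → Connected H x y → Connected H y x
  Connected-sym here = here
  Connected-sym {H} (step a p) = Connected-trans (Connected-sym p) (Adj⇒Connected (Adj-sym H a))

  Connected-mono : ∀ {H H′ : Graph n} → H ⊑ H′ → ∀ {x y} → Connected H x y → Connected H′ x y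
  Connected-mono H⊑H′ here = here
  Connected-mono H⊑H′ (step a p) = step (H⊑H′ a) (Connected-mono H⊑H′ p)

  path⇒Connected : ∀ {H : Graph n} {k} (v : Fin (suc k) → Fin n) →
                   (∀ i → Adj H (v (inject₁ i)) (v (suc i))) → ∀ i j → Connected H (v i) (v j)
  path⇒Connected {H} v edges i j = Connected-trans (Connected-sym (from-start v edges i)) (from-start v edges j)
    where
      from-start : ∀ {k} (v : Fin (suc k) → Fin n) →
                   (∀ i → Adj H (v (inject₁ i)) (v (suc i))) → ∀ i → Connected H (v zero) (v i)
      from-start v edges zero = here
      from-start {suc k} v edges (suc i) = step (edges zero) (from-start (v ∘ suc) (edges ∘ suc) i)

  SameEdge : Fin n → Fin n → Fin n → Fin n → Set
  SameEdge p q x y = (x ≡ p × y ≡ q) ⊎ (x ≡ q × y ≡ p)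

  sameEdge? : ∀ p q x y → Dec (SameEdge p q x y)
  sameEdge? p q x y = (x ≟ p ×-dec y ≟ q) ⊎-dec (x ≟ q ×-dec y ≟ p)

  SameEdge-flip : ∀ {p q x y} → SameEdge p q x y → SameEdge p q y x
  SameEdge-flip = Sum.swap ∘ Sum.map Prod.swap Prod.swap

  deleteEdge : Graph n → Fin n → Fin n → Graph n
  adj (deleteEdge H p q) x y = adj H x y ∧ not (does (sameEdge? p q x y))
  sym (deleteEdge H p q) x y =
    cong₂ (λ b c → b ∧ not c) (sym H x y)
          (does-⇔ (mk⇔ SameEdge-flip SameEdge-flip) (sameEdge? p q x y) (sameEdge? p q y x))
  irrefl (deleteEdge H p q) x = cong (_∧ _) (irrefl H x)

  adj-deleteEdge : ∀ H {p q x y} → ¬ SameEdge p q x y → adj (deleteEdge H p q) x y ≡ adj H x y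
  adj-deleteEdge H {p} {q} {x} {y} ¬e rewrite dec-false (sameEdge? p q x y) ¬e = ∧-identityʳ (adj H x y)

  Adj-deleteEdge : ∀ H {p q x y} → Adj H x y → ¬ SameEdge p q x y → Adj (deleteEdge H p q) x y
  Adj-deleteEdge H a ¬e = trans (adj-deleteEdge H ¬e) a

  deleteEdge-⊑ : ∀ H {p q} → deleteEdge H p q ⊑ H
  deleteEdge-⊑ H {u = u} {v} = ∧-conicalˡ (adj H u v) _

  adj-deleteEdge-comm : ∀ H p q x y → adj (deleteEdge H q p) x y ≡ adj (deleteEdge H p q) x y
  adj-deleteEdge-comm H p q x y =
    cong (λ b → adj H x y ∧ not b) (does-⇔ (mk⇔ Sum.swap Sum.swap) (sameEdge? q p x y) (sameEdge? p q x y))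

  Connected-deleteEdge : ∀ {H : Graph n} {u v} → Connected (deleteEdge H u v) u v →
                         ∀ {x y} → Connected H x y → Connected (deleteEdge H u v) x y
  Connected-deleteEdge cuv here = here
  Connected-deleteEdge {H} {u} {v} cuv (step {x} {z} a p) with sameEdge? u v x z
  ... | no ¬e = step (Adj-deleteEdge H a ¬e) (Connected-deleteEdge cuv p)
  ... | yes (inj₁ (refl , refl)) = Connected-trans cuv (Connected-deleteEdge cuv p)
  ... | yes (inj₂ (refl , refl)) = Connected-trans (Connected-sym cuv) (Connected-deleteEdge cuv p)

  Connected-deleteEdge-split : ∀ {H : Graph n} {u v x} → Connected H x u →
                               Connected (deleteEdge H u v) x u ⊎ Connected (deleteEdge H u v) x v
  Connected-deleteEdge-split here = inj₁ here
  Connected-deleteEdge-split {H} {u} {v} (step {x} {z} a p) with sameEdge? u v x z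
  ... | yes (inj₁ (refl , refl)) = inj₁ here
  ... | yes (inj₂ (refl , refl)) = inj₂ here
  ... | no ¬e = Sum.map (step (Adj-deleteEdge H a ¬e)) (step (Adj-deleteEdge H a ¬e))
                        (Connected-deleteEdge-split p)

  countIfOrdered : Fin n → Fin n → Bool → ℕ
  countIfOrdered u v b = if (toℕ u <ᵇ toℕ v) ∧ b then 1 else 0

  edgeIndicator : Graph n → Fin n → Fin n → ℕ
  edgeIndicator H u v = countIfOrdered u v (adj H u v)

  edgeCount≡∑∑ : ∀ H → edgeCount H ≡ ∑ (∑ ∘ edgeIndicator H)
  edgeCount≡∑∑ H =
    trans (sum-concatMap (λ u → map (edgeIndicator H u) (allFin n)) (allFin n))
      (trans (sum-map-allFin (λ u → sum (map (edgeIndicator H u) (allFin n))))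
             (∑-cong (λ u → sum-map-allFin (edgeIndicator H u))))

  edgeCount-cong : ∀ {H H′} → (∀ x y → adj H x y ≡ adj H′ x y) → edgeCount H ≡ edgeCount H′
  edgeCount-cong {H} {H′} adj≗ =
    trans (edgeCount≡∑∑ H)
      (trans (∑-cong λ u → ∑-cong λ v → cong (countIfOrdered u v) (adj≗ u v))
             (≡.sym (edgeCount≡∑∑ H′)))

  edgeCount-deleteEdge< : ∀ H {p q} → Adj H p q → toℕ p < toℕ q →
                          edgeCount H ≡ suc (edgeCount (deleteEdge H p q))
  edgeCount-deleteEdge< H {p} {q} apq p<q =
    trans (edgeCount≡∑∑ H)
      (trans (∑∑-suc-at (edgeIndicator H) (edgeIndicator H′) p q off at)
             (cong suc (≡.sym (edgeCount≡∑∑ H′))))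
    where
      H′ = deleteEdge H p q
      off : ∀ u v → ¬ (u ≡ p × v ≡ q) → edgeIndicator H u v ≡ edgeIndicator H′ u v
      off u v ¬pq with sameEdge? p q u v
      ... | no ¬e = cong (countIfOrdered u v) (≡.sym (adj-deleteEdge H ¬e))
      ... | yes (inj₁ pq) = contradiction pq ¬pq
      ... | yes (inj₂ (refl , refl)) rewrite <⇒>ᵇ≡false p<q = refl
      at : edgeIndicator H p q ≡ suc (edgeIndicator H′ p q)
      at rewrite <⇒<ᵇ≡true p<q | apq | dec-true (sameEdge? p q p q) (inj₁ (refl , refl)) = refl

  edgeCount-deleteEdge : ∀ H {p q} → Adj H p q → edgeCount H ≡ suc (edgeCount (deleteEdge H p q))
  edgeCount-deleteEdge H {p} {q} apq with <-cmp (toℕ p) (toℕ q)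
  ... | tri< p<q _ _ = edgeCount-deleteEdge< H apq p<q
  ... | tri≈ _ p≡q _ = contradiction (toℕ-injective p≡q) (Adj-irrefl H apq)
  ... | tri> _ _ q<p = trans (edgeCount-deleteEdge< H (Adj-sym H apq) q<p)
                             (cong suc (edgeCount-cong {deleteEdge H q p} {deleteEdge H p q}
                                                       (adj-deleteEdge-comm H p q)))

  Adj? : ∀ H (u v : Fin n) → Dec (Adj H u v)
  Adj? H u v = adj H u v Bool.≟ true

  edge? : ∀ H → Dec (∃[ u ] ∃[ v ] Adj H u v)
  edge? H = any? λ u → any? (Adj? H u)

  IsComponentLabelling : ∀ {k} → Graph n → (Fin n → Fin k) → Set
  IsComponentLabelling H c = ∀ x y → (c x ≡ c y → Connected H x y) × (Connected H x y → c x ≡ c y)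

  deleteEdge-labelling : ∀ {H : Graph n} {k} {c : Fin n → Fin k} {u v} → Connected (deleteEdge H u v) u v →
                         IsComponentLabelling H c → IsComponentLabelling (deleteEdge H u v) c
  deleteEdge-labelling {H} cuv lab x y =
    Connected-deleteEdge cuv ∘ proj₁ (lab x y) , proj₂ (lab x y) ∘ Connected-mono (deleteEdge-⊑ H)

  -- Deleting a bridge splits the component of u and v in two; the v-side gets the new label.
  module DeleteBridge {H : Graph n} {k} {c : Fin n → Fin k} (lab : IsComponentLabelling H c)
                      {u v} (auv : Adj H u v) (bridge : ¬ Connected (deleteEdge H u v) u v) where

    H′ = deleteEdge H u v

    c-Connected : ∀ {x y} → Connected H′ x y → c x ≡ c y
    c-Connected = proj₂ (lab _ _) ∘ Connected-mono (deleteEdge-⊑ H)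

    cu≡cv : c u ≡ c v
    cu≡cv = proj₂ (lab u v) (Adj⇒Connected auv)

    data Side (x : Fin n) : Set where
      away  : c x ≢ c u → Side x
      uSide : Connected H′ x u → Side x
      vSide : Connected H′ x v → Side x

    side : ∀ x → Side x
    side x with c x ≟ c u
    ... | no cx≢cu = away cx≢cu
    ... | yes cx≡cu = [ uSide , vSide ]′ (Connected-deleteEdge-split (proj₁ (lab x u) cx≡cu))

    label : ∀ {x} → Side x → Fin (suc k)
    label {x} (away _)  = inject₁ (c x)
    label {x} (uSide _) = inject₁ (c x)
    label     (vSide _) = fromℕ k

    away-Connected : ∀ {x y} → c x ≢ c u → Connected H x y → Connected H′ x y
    away-Connected cx≢cu here = here
    away-Connected {x} cx≢cu (step {v = z} axz p) with sameEdge? u v x z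
    ... | no ¬e = step (Adj-deleteEdge H axz ¬e)
                       (away-Connected (cx≢cu ∘ trans (proj₂ (lab x z) (Adj⇒Connected axz))) p)
    ... | yes (inj₁ (refl , _)) = ⊥-elim (cx≢cu refl)
    ... | yes (inj₂ (_ , refl)) = ⊥-elim (cx≢cu (proj₂ (lab x u) (Adj⇒Connected axz)))

    sound : ∀ {x y} (sx : Side x) (sy : Side y) → label sx ≡ label sy → Connected H′ x y
    sound (away cx≢cu) (away _) e = away-Connected cx≢cu (proj₁ (lab _ _) (inject₁-injective e))
    sound (away cx≢cu) (uSide yu) e = ⊥-elim (cx≢cu (trans (inject₁-injective e) (c-Connected yu)))
    sound (away _) (vSide _) e = ⊥-elim (fromℕ≢inject₁ (≡.sym e))
    sound (uSide xu) (away cy≢cu) e = ⊥-elim (cy≢cu (trans (≡.sym (inject₁-injective e)) (c-Connected xu)))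
    sound (uSide xu) (uSide yu) _ = Connected-trans xu (Connected-sym yu)
    sound (uSide _) (vSide _) e = ⊥-elim (fromℕ≢inject₁ (≡.sym e))
    sound (vSide _) (away _) e = ⊥-elim (fromℕ≢inject₁ e)
    sound (vSide _) (uSide _) e = ⊥-elim (fromℕ≢inject₁ e)
    sound (vSide xv) (vSide yv) _ = Connected-trans xv (Connected-sym yv)

    complete : ∀ {x y} (sx : Side x) (sy : Side y) → Connected H′ x y → label sx ≡ label sy
    complete (away _) (away _) p = cong inject₁ (c-Connected p)
    complete (away cx≢cu) (uSide yu) p = ⊥-elim (cx≢cu (trans (c-Connected p) (c-Connected yu)))
    complete (away cx≢cu) (vSide yv) p =
      ⊥-elim (cx≢cu (trans (c-Connected p) (trans (c-Connected yv) (≡.sym cu≡cv))))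
    complete (uSide xu) (away cy≢cu) p = ⊥-elim (cy≢cu (trans (≡.sym (c-Connected p)) (c-Connected xu)))
    complete (uSide _) (uSide _) p = cong inject₁ (c-Connected p)
    complete (uSide xu) (vSide yv) p = ⊥-elim (bridge (Connected-trans (Connected-sym xu) (Connected-trans p yv)))
    complete (vSide xv) (away cy≢cu) p =
      ⊥-elim (cy≢cu (trans (≡.sym (c-Connected p)) (trans (c-Connected xv) (≡.sym cu≡cv))))
    complete (vSide xv) (uSide yu) p =
      ⊥-elim (bridge (Connected-trans (Connected-sym yu) (Connected-trans (Connected-sym p) xv)))
    complete (vSide _) (vSide _) _ = refl

    labelling : IsComponentLabelling H′ (λ x → label (side x))
    labelling x y = sound (side x) (side y) , complete (side x) (side y)

  components+edges≮vertices : ∀ {k} (H : Graph n) {c : Fin n → Fin k} →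
                              IsComponentLabelling H c → k + edgeCount H ≮ n
  components+edges≮vertices H lab = go _ H lab refl
    where
      go : ∀ m {k} (H : Graph n) {c : Fin n → Fin k} → IsComponentLabelling H c →
           edgeCount H ≡ m → k + m ≮ n
      go m {k} H {c} lab _ k+m<n with edge? H
      go m {k} H {c} lab _ k+m<n | no noEdge = <⇒≱ k+m<n (≤-trans (injective⇒≤ c-injective) (m≤m+n k m))
        where
          c-injective : ∀ {x y} → c x ≡ c y → x ≡ y
          c-injective {x} {y} cx≡cy with proj₁ (lab x y) cx≡cy
          ... | here = refl
          ... | step {v = z} axz _ = ⊥-elim (noEdge (x , z , axz))
      go zero H lab ec _ | yes (_ , _ , auv) = contradiction (trans (≡.sym ec) (edgeCount-deleteEdge H auv)) λ ()
      go (suc m) {k} H lab ec k+m<n | yes (u , v , auv) = ¬¬-excluded-middle byBridge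
        where
          H′ = deleteEdge H u v
          ec′ : edgeCount H′ ≡ m
          ec′ = suc-injective (trans (≡.sym (edgeCount-deleteEdge H auv)) ec)
          -- Connectivity in H′ is not decided, but the goal is ⊥, so excluded middle for it is available.
          byBridge : ¬ Dec (Connected H′ u v)
          byBridge (yes cuv) =
            go m H′ (deleteEdge-labelling cuv lab) ec′ (≤-<-trans (+-monoʳ-≤ k (n≤1+n m)) k+m<n)
          byBridge (no bridge) =
            go m H′ (DeleteBridge.labelling lab auv bridge) ec′ (subst (_< n) (+-suc k m) k+m<n)

  Acyclic : Graph n → Set
  Acyclic H = ∀ {x y} → Adj H x y → ¬ Connected (deleteEdge H x y) x y

  H1isOne⇒deleteCycleEdge-acyclic : ∀ {G : Graph n} → H1isOne G → ∀ {p q} → Adj G p q →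
                                     Connected (deleteEdge G p q) p q → Acyclic (deleteEdge G p q)
  H1isOne⇒deleteCycleEdge-acyclic {G} (κ , (_ , _ , lab) , κ+e≡n+1) {p} {q} apq cpq {x} {y} axy cxy =
    components+edges≮vertices G₂ (deleteEdge-labelling cxy (deleteEdge-labelling cpq lab)) κ+e₂<n
    where
      open ≡-Reasoning
      G₁ = deleteEdge G p q
      G₂ = deleteEdge G₁ x y
      e₂ = edgeCount G₂
      κ+e₂<n : κ + e₂ < n
      κ+e₂<n = ≤-reflexive (suc-injective (begin
        suc (suc (κ + e₂))  ≡⟨ ≡.sym (trans (+-suc κ (suc e₂)) (cong suc (+-suc κ e₂))) ⟩
        κ + suc (suc e₂)    ≡⟨ cong (κ +_) (≡.sym (trans (edgeCount-deleteEdge G apq)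
                                                         (cong suc (edgeCount-deleteEdge G₁ axy)))) ⟩
        κ + edgeCount G     ≡⟨ κ+e≡n+1 ⟩
        n + 1               ≡⟨ +-comm n 1 ⟩
        suc n               ∎))

  induced : Graph n → Subset n → Graph n
  adj (induced H A) x y = adj H x y ∧ (does (x ∈? A) ∧ does (y ∈? A))
  sym (induced H A) x y = cong₂ _∧_ (sym H x y) (∧-comm (does (x ∈? A)) (does (y ∈? A)))
  irrefl (induced H A) x = cong (_∧ _) (irrefl H x)

  Adj-induced : ∀ H {A x y} → Adj H x y → x ∈ A → y ∈ A → Adj (induced H A) x y
  Adj-induced H {A} {x} {y} a x∈A y∈A rewrite a | dec-true (x ∈? A) x∈A | dec-true (y ∈? A) y∈A = refl

  Adj-induced⁻ : ∀ H {A x y} → Adj (induced H A) x y → Adj H x y × x ∈ A × y ∈ A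
  Adj-induced⁻ H {A} {x} {y} a =
    ∧-conicalˡ _ _ a , does⇒ (x ∈? A) (∧-conicalˡ _ _ x,y∈A) , does⇒ (y ∈? A) (∧-conicalʳ _ _ x,y∈A)
    where
      x,y∈A : does (x ∈? A) ∧ does (y ∈? A) ≡ true
      x,y∈A = ∧-conicalʳ (adj H x y) _ a

  induced-mono : ∀ H {A B} → A ⊆ B → induced H A ⊑ induced H B
  induced-mono H A⊆B a with Adj-induced⁻ H a
  ... | a′ , x∈A , y∈A = Adj-induced H a′ (A⊆B x∈A) (A⊆B y∈A)

  induced⊑deleteEdge : ∀ H {A z} → z ∉ A → ∀ q → induced H A ⊑ deleteEdge H z q
  induced⊑deleteEdge H z∉A q a with Adj-induced⁻ H a
  ... | a′ , x∈A , y∈A = Adj-deleteEdge H a′ λ where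
    (inj₁ (refl , _)) → z∉A x∈A
    (inj₂ (_ , refl)) → z∉A y∈A

  ∈∁⁅⁆⁺ : ∀ {x w : Fin n} → x ≢ w → x ∈ ∁ ⁅ w ⁆
  ∈∁⁅⁆⁺ = x∉p⇒x∈∁p ∘ x≢y⇒x∉⁅y⁆

  ∈∁⁅⁆⁻ : ∀ {x w : Fin n} → x ∈ ∁ ⁅ w ⁆ → x ≢ w
  ∈∁⁅⁆⁻ = x∉⁅y⁆⇒x≢y ∘ x∈∁p⇒x∉p

-- In an acyclic graph, a walk through F that never turns back can only stop at a vertex of T.
module AcyclicWalk {n} {H : Graph n} (acyclic : Acyclic H)
  (F : Subset n) {T : Fin n → Set} (T? : Decidable T)
  (branch : ∀ {p z} → p ∈ F → z ∈ F → ¬ T z → Adj H p z → ∃[ q ] (q ∈ F × Adj H z q × q ≢ p)) where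

  -- A walk from p₀ that has visited V and arrived at z from prev.  Every other visited vertex is
  -- reachable from prev inside V avoiding z, so an edge from z back into V closes a cycle.
  record Walk (p₀ : Fin n) (V : Subset n) (prev z : Fin n) : Set where
    field
      prev∈F    : prev ∈ F
      z∈F       : z ∈ F
      edge      : Adj H prev z
      prev∈V    : prev ∈ V
      z∈V       : z ∈ V
      p₀∈V      : p₀ ∈ V
      z≢p₀      : z ≢ p₀
      backtrack : ∀ {r} → r ∈ V → r ≢ z → Connected (induced H (V ∩ ∁ ⁅ z ⁆)) prev r

  extend : ∀ {p₀ V prev z q} → Walk p₀ V prev z → q ∈ F → Adj H z q → q ∉ V →
           Walk p₀ (V ∪ ⁅ q ⁆) z q
  extend {p₀} {V} {prev} {z} {q} w q∈F azq q∉V = record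
    { prev∈F = z∈F ; z∈F = q∈F ; edge = azq ; prev∈V = old z∈V ; z∈V = x∈p∪q⁺ (inj₂ (x∈⁅x⁆ q))
    ; p₀∈V = old p₀∈V ; z≢p₀ = λ { refl → q∉V p₀∈V } ; backtrack = backtrack′ }
    where
      open Walk w
      old : V ⊆ V ∪ ⁅ q ⁆
      old = p⊆p∪q ⁅ q ⁆
      fresh : ∀ {r} → r ∈ V → r ∈ (V ∪ ⁅ q ⁆) ∩ ∁ ⁅ q ⁆
      fresh r∈V = x∈p∩q⁺ (old r∈V , ∈∁⁅⁆⁺ λ { refl → q∉V r∈V })
      backtrack′ : ∀ {r} → r ∈ V ∪ ⁅ q ⁆ → r ≢ q →
                   Connected (induced H ((V ∪ ⁅ q ⁆) ∩ ∁ ⁅ q ⁆)) z r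
      backtrack′ {r} r∈V′ r≢q with r ≟ z
      ... | yes refl = here
      ... | no r≢z =
        step (Adj-induced H (Adj-sym H edge) (fresh z∈V) (fresh prev∈V))
             (Connected-mono (induced-mono H (fresh ∘ proj₁ ∘ x∈p∩q⁻ V (∁ ⁅ z ⁆)))
                             (backtrack r∈V r≢z))
        where
          r∈V : r ∈ V
          r∈V = [ id , (λ r∈q → contradiction (x∈⁅y⁆⇒x≡y q r∈q) r≢q) ]′
                  (x∈p∪q⁻ V ⁅ q ⁆ r∈V′)

  stuck : ∀ {p₀ V prev z} → Walk p₀ V prev z → ¬ T z → (∀ {q} → q ∈ F → Adj H z q → q ∈ V) → ⊥
  stuck {V = V} {prev} {z} w ¬Tz closed with branch (Walk.prev∈F w) (Walk.z∈F w) ¬Tz (Walk.edge w)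
  ... | q , q∈F , azq , q≢prev =
    acyclic azq (step z→prev (Connected-mono (induced⊑deleteEdge H z∉V∖z q)
                                             (backtrack (closed q∈F azq) q≢z)))
    where
      open Walk w
      q≢z : q ≢ z
      q≢z q≡z = Adj-irrefl H azq (≡.sym q≡z)
      z∉V∖z : z ∉ V ∩ ∁ ⁅ z ⁆
      z∉V∖z z∈ = ∈∁⁅⁆⁻ (proj₂ (x∈p∩q⁻ V _ z∈)) refl
      z→prev : Adj (deleteEdge H z q) z prev
      z→prev = Adj-deleteEdge H (Adj-sym H edge) λ where
        (inj₁ (_ , prev≡q)) → q≢prev (≡.sym prev≡q)
        (inj₂ (z≡q , _)) → q≢z (≡.sym z≡q)

  walk : ∀ {p₀ V prev z} → Acc _⊃_ V → Walk p₀ V prev z →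
         ∃[ t ] (T t × Connected (induced H (∁ ⁅ p₀ ⁆)) z t)
  walk {p₀} {V} {prev} {z} (acc more) w with any? (λ q → q ∈? F ×-dec Adj? H z q ×-dec ¬? (q ∈? V))
  ... | yes (q , q∈F , azq , q∉V) =
    let V⊂V∪q : V ⊂ V ∪ ⁅ q ⁆
        V⊂V∪q = p⊆p∪q ⁅ q ⁆ , q , x∈p∪q⁺ (inj₂ (x∈⁅x⁆ q)) , q∉V
        t , Tt , q⇝t = walk (more V⊂V∪q) (extend w q∈F azq q∉V)
    in t , Tt , step (Adj-induced H azq (∈∁⁅⁆⁺ z≢p₀) (∈∁⁅⁆⁺ λ { refl → q∉V p₀∈V })) q⇝t
    where open Walk w
  ... | no none with T? z
  ...   | yes Tz = z , Tz , here
  ...   | no ¬Tz = ⊥-elim (stuck w ¬Tz λ {q} q∈F azq →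
                     decidable-stable (q ∈? V) λ q∉V → none (q , q∈F , azq , q∉V))

  walk-to-target : ∀ {p z} → p ∈ F → z ∈ F → Adj H p z →
                   ∃[ t ] (T t × Connected (induced H (∁ ⁅ p ⁆)) z t)
  walk-to-target {p} {z} p∈F z∈F apz = walk (⊃-wellFounded _) (record
    { prev∈F = p∈F ; z∈F = z∈F ; edge = apz ; prev∈V = p∈V ; z∈V = x∈p∪q⁺ (inj₂ (x∈⁅x⁆ z))
    ; p₀∈V = p∈V ; z≢p₀ = λ z≡p → Adj-irrefl H apz (≡.sym z≡p) ; backtrack = start })
    where
      p∈V : p ∈ ⁅ p ⁆ ∪ ⁅ z ⁆
      p∈V = x∈p∪q⁺ (inj₁ (x∈⁅x⁆ p))
      start : ∀ {r} → r ∈ ⁅ p ⁆ ∪ ⁅ z ⁆ → r ≢ z →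
              Connected (induced H ((⁅ p ⁆ ∪ ⁅ z ⁆) ∩ ∁ ⁅ z ⁆)) p r
      start {r} r∈V r≢z with x∈p∪q⁻ ⁅ p ⁆ ⁅ z ⁆ r∈V
      ... | inj₁ r∈p rewrite x∈⁅y⁆⇒x≡y p r∈p = here
      ... | inj₂ r∈z = contradiction (x∈⁅y⁆⇒x≡y z r∈z) r≢z

record MinDegree≥2 {n} (G : Graph n) (F : Subset n) : Set where
  field
    neighbour        : ∀ {w} → w ∈ F → ∃[ x ] (x ∈ F × Adj G w x)
    anotherNeighbour : ∀ {w x} → w ∈ F → x ∈ F → Adj G w x → ∃[ y ] (y ∈ F × Adj G w y × y ≢ x)

module Unicyclic {n} {G : Graph n} (h₁≡1 : H1isOne G) (C : Cycle G) where

  last : Fin (suc (suc (suc (m C))))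
  last = fromℕ (suc (suc (m C)))

  a b : Fin n
  a = vtx C last
  b = vtx C zero

  G₁ : Graph n
  G₁ = deleteEdge G a b

  CycStep⇒Adj : ∀ {u v} → CycStep C u v → Adj G u v
  CycStep⇒Adj (inj₁ (i , refl , refl)) = edges C i
  CycStep⇒Adj (inj₂ (refl , refl)) = closing C

  CycEdge⇒Adj : ∀ {u v} → CycEdge C u v → Adj G u v
  CycEdge⇒Adj = [ CycStep⇒Adj , Adj-sym G ∘ CycStep⇒Adj ]′

  onCycle? : ∀ u → Dec (OnCycle C u)
  onCycle? u = any? λ i → vtx C i ≟ u

  cycStep? : ∀ u v → Dec (CycStep C u v)
  cycStep? u v = any? (λ i → vtx C (inject₁ i) ≟ u ×-dec vtx C (suc i) ≟ v) ⊎-dec (a ≟ u ×-dec b ≟ v)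

  ¬closingEdge : ∀ i → ¬ SameEdge a b (vtx C (inject₁ i)) (vtx C (suc i))
  ¬closingEdge i (inj₁ (i≡last , _)) = fromℕ≢inject₁ (≡.sym (inj C i≡last))
  ¬closingEdge zero (inj₂ (_ , 1≡last)) with inj C 1≡last
  ... | ()
  ¬closingEdge (suc i) (inj₂ (i+1≡0 , _)) with inj C i+1≡0
  ... | ()

  cycleEdge-G₁ : ∀ i → Adj G₁ (vtx C (inject₁ i)) (vtx C (suc i))
  cycleEdge-G₁ i = Adj-deleteEdge G (edges C i) (¬closingEdge i)

  onCycle-Connected : ∀ {H} → (∀ i → Adj H (vtx C (inject₁ i)) (vtx C (suc i))) →
                      ∀ {u v} → OnCycle C u → OnCycle C v → Connected H u v
  onCycle-Connected path (i , refl) (j , refl) = path⇒Connected (vtx C) path i j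

  G₁-acyclic : Acyclic G₁
  G₁-acyclic =
    H1isOne⇒deleteCycleEdge-acyclic h₁≡1 (closing C) (path⇒Connected (vtx C) cycleEdge-G₁ last zero)

  chordless : ∀ {u v} → OnCycle C u → OnCycle C v → Adj G u v → CycEdge C u v
  chordless {u} {v} u∈C v∈C auv with cycStep? u v ⊎-dec cycStep? v u
  ... | yes e = e
  ... | no ¬e = ⊥-elim (G₁-acyclic auv₁ (onCycle-Connected avoiding-uv u∈C v∈C))
    where
      auv₁ : Adj G₁ u v
      auv₁ = Adj-deleteEdge G auv λ where
        (inj₁ (u≡a , v≡b)) → ¬e (inj₁ (inj₂ (≡.sym u≡a , ≡.sym v≡b)))
        (inj₂ (u≡b , v≡a)) → ¬e (inj₂ (inj₂ (≡.sym v≡a , ≡.sym u≡b)))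
      avoiding-uv : ∀ i → Adj (deleteEdge G₁ u v) (vtx C (inject₁ i)) (vtx C (suc i))
      avoiding-uv i = Adj-deleteEdge G₁ (cycleEdge-G₁ i) λ where
        (inj₁ (e₁ , e₂)) → ¬e (inj₁ (inj₁ (i , e₁ , e₂)))
        (inj₂ (e₁ , e₂)) → ¬e (inj₂ (inj₁ (i , e₁ , e₂)))

  CycStep-functional : ∀ {w s s′} → CycStep C w s → CycStep C w s′ → s ≡ s′
  CycStep-functional (inj₁ (i , e₁ , e₂)) (inj₁ (j , f₁ , f₂))
    with inject₁-injective (inj C (trans e₁ (≡.sym f₁)))
  ... | refl = trans (≡.sym e₂) f₂
  CycStep-functional (inj₁ (i , e₁ , _)) (inj₂ (f₁ , _)) =
    ⊥-elim (fromℕ≢inject₁ (inj C (trans f₁ (≡.sym e₁))))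
  CycStep-functional (inj₂ (e₁ , _)) (inj₁ (j , f₁ , _)) =
    ⊥-elim (fromℕ≢inject₁ (inj C (trans e₁ (≡.sym f₁))))
  CycStep-functional (inj₂ (_ , e₂)) (inj₂ (_ , f₂)) = trans (≡.sym e₂) f₂

  CycStep-injective : ∀ {w r r′} → CycStep C r w → CycStep C r′ w → r ≡ r′
  CycStep-injective (inj₁ (i , e₁ , e₂)) (inj₁ (j , f₁ , f₂))
    with Fin.suc-injective (inj C (trans e₂ (≡.sym f₂)))
  ... | refl = trans (≡.sym e₁) f₁
  CycStep-injective (inj₁ (i , _ , e₂)) (inj₂ (_ , f₂)) with inj C (trans e₂ (≡.sym f₂))
  ... | ()
  CycStep-injective (inj₂ (_ , e₂)) (inj₁ (j , _ , f₂)) with inj C (trans f₂ (≡.sym e₂))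
  ... | ()
  CycStep-injective (inj₂ (e₁ , _)) (inj₂ (f₁ , _)) = trans (≡.sym e₁) f₁

  ClosingEnd : Fin n → Set
  ClosingEnd z = z ≡ a ⊎ z ≡ b

  ClosingEnd-onCycle : ∀ {z} → ClosingEnd z → OnCycle C z
  ClosingEnd-onCycle (inj₁ z≡a) = last , ≡.sym z≡a
  ClosingEnd-onCycle (inj₂ z≡b) = zero , ≡.sym z≡b

  Adj⇒Adj-G₁ : ∀ {z q} → ¬ ClosingEnd z → Adj G z q → Adj G₁ z q
  Adj⇒Adj-G₁ ¬end azq = Adj-deleteEdge G azq (¬end ∘ Sum.map proj₁ proj₁)

  module _ {F : Subset n} (deg : MinDegree≥2 G F) where
    open MinDegree≥2 deg

    private
      branch : ∀ {p z} → p ∈ F → z ∈ F → ¬ ClosingEnd z → Adj G₁ p z →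
               ∃[ q ] (q ∈ F × Adj G₁ z q × q ≢ p)
      branch p∈F z∈F ¬end apz with anotherNeighbour z∈F p∈F (Adj-sym G (deleteEdge-⊑ G apz))
      ... | q , q∈F , azq , q≢p = q , q∈F , Adj⇒Adj-G₁ ¬end azq , q≢p

      open AcyclicWalk G₁-acyclic F (λ z → z ≟ a ⊎-dec z ≟ b) branch using (walk-to-target)

    -- Walks from two F-neighbours of an off-cycle w both reach the cycle, closing a cycle in G₁ through w.
    offCycle-absurd : ∀ {w x y} → w ∈ F → ¬ OnCycle C w → x ∈ F → y ∈ F →
                      Adj G₁ w x → Adj G₁ w y → y ≢ x → ⊥
    offCycle-absurd {w} {x} {y} w∈F w∉C x∈F y∈F awx awy y≢x
      with walk-to-target w∈F x∈F awx | walk-to-target w∈F y∈F awy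
    ... | s , s-end , x⇝s | t , t-end , y⇝t = G₁-acyclic awx (Connected-sym x⇝w)
      where
        s⇝t : Connected (induced G₁ (∁ ⁅ w ⁆)) s t
        s⇝t = onCycle-Connected (λ i → Adj-induced G₁ (cycleEdge-G₁ i) (≢w (inject₁ i)) (≢w (suc i)))
                                (ClosingEnd-onCycle s-end) (ClosingEnd-onCycle t-end)
          where
            ≢w : ∀ i → vtx C i ∈ ∁ ⁅ w ⁆
            ≢w i = ∈∁⁅⁆⁺ λ e → w∉C (i , e)
        x⇝y : Connected (deleteEdge G₁ w x) x y
        x⇝y = Connected-mono (induced⊑deleteEdge G₁ (λ w∈ → ∈∁⁅⁆⁻ w∈ refl) x)
                             (Connected-trans x⇝s (Connected-trans s⇝t (Connected-sym y⇝t)))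
        x⇝w : Connected (deleteEdge G₁ w x) x w
        x⇝w = Connected-trans x⇝y (Adj⇒Connected (Adj-deleteEdge G₁ (Adj-sym G₁ awy) λ where
                (inj₁ (y≡w , _)) → Adj-irrefl G₁ awy (≡.sym y≡w)
                (inj₂ (y≡x , _)) → y≢x y≡x))

    minDegree≥2⊆cycle : ∀ {w} → w ∈ F → OnCycle C w
    minDegree≥2⊆cycle {w} w∈F with onCycle? w | neighbour w∈F
    ... | yes w∈C | _ = w∈C
    ... | no w∉C | x , x∈F , awx with anotherNeighbour w∈F x∈F awx
    ...   | y , y∈F , awy , y≢x = ⊥-elim (offCycle-absurd w∈F w∉C x∈F y∈F (toG₁ awx) (toG₁ awy) y≢x)
      where
        toG₁ : ∀ {v} → Adj G w v → Adj G₁ w v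
        toG₁ = Adj⇒Adj-G₁ (w∉C ∘ ClosingEnd-onCycle)

    -- Both F-neighbours of w are cycle-neighbours; they cannot both be its predecessor.
    successor-∈ : ∀ {w s} → w ∈ F → CycStep C w s → s ∈ F
    successor-∈ {w} {s} w∈F w→s with s ∈? F | neighbour w∈F
    ... | yes s∈F | _ = s∈F
    ... | no s∉F | x , x∈F , awx with anotherNeighbour w∈F x∈F awx
    ...   | y , y∈F , awy , y≢x =
      ⊥-elim (y≢x (CycStep-injective (predecessor y∈F awy) (predecessor x∈F awx)))
      where
        predecessor : ∀ {x} → x ∈ F → Adj G w x → CycStep C x w
        predecessor x∈F awx with chordless (minDegree≥2⊆cycle w∈F) (minDegree≥2⊆cycle x∈F) awx
        ... | inj₂ x→w = x→w
        ... | inj₁ w→x = ⊥-elim (s∉F (subst (_∈ F) (CycStep-functional w→x w→s) x∈F))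

    cycle⊆minDegree≥2 : ∀ {w u} → w ∈ F → OnCycle C u → u ∈ F
    cycle⊆minDegree≥2 w∈F (i , refl) with minDegree≥2⊆cycle w∈F
    ... | j , refl = <-weakInduction P P₀ next i
      where
        P : Fin _ → Set
        P i = vtx C i ∈ F
        next : ∀ i → P (inject₁ i) → P (suc i)
        next i Pi = successor-∈ Pi (inj₁ (i , refl , refl))
        P₀ : P zero
        P₀ = successor-∈ (<-weakInduction-startingFrom P w∈F next (≤fromℕ j)) (inj₂ (refl , refl))

module _ {n : ℕ} where

  ≐-refl : ∀ {I : Ideal n} → I ≐ I
  ≐-refl S = id , id

  ≐-sym : ∀ {I J : Ideal n} → I ≐ J → J ≐ I
  ≐-sym I≐J S = Prod.swap (I≐J S)

  ≐-trans : ∀ {I J K : Ideal n} → I ≐ J → J ≐ K → I ≐ K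
  ≐-trans I≐J J≐K S = proj₁ (J≐K S) ∘ proj₁ (I≐J S) , proj₂ (I≐J S) ∘ proj₂ (J≐K S)

  colon-cong : ∀ {I J : Ideal n} a → I ≐ J → colon I a ≐ colon J a
  colon-cong a I≐J S = Sum.map₂ (proj₁ (I≐J _)) , Sum.map₂ (proj₂ (I≐J _))

  addVar-cong : ∀ {I J : Ideal n} a → I ≐ J → addVar I a ≐ addVar J a
  addVar-cong a I≐J S = Sum.map₂ (proj₁ (I≐J _)) , Sum.map₂ (proj₂ (I≐J _))

  IsCone-cong : ∀ {I J : Ideal n} {a} → I ≐ J → IsCone I a → IsCone J a
  IsCone-cong {a = a} I≐J cone = ≐-trans (colon-cong a (≐-sym I≐J)) (≐-trans cone (addVar-cong a I≐J))

  Dominates-cong : ∀ {I J : Ideal n} {a b} → I ≐ J → Dominates I a b → Dominates J a b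
  Dominates-cong {a = a} I≐J (¬cone , cone) =
    ¬cone ∘ IsCone-cong (≐-sym I≐J) , IsCone-cong (addVar-cong a I≐J) cone

  IsResolution-cong : ∀ {I J : Ideal n} as → I ≐ J → IsResolution I as → IsResolution J as
  IsResolution-cong [] _ _ = tt
  IsResolution-cong (a ∷ as) I≐J (a∉I , legal , res) =
    a∉I ∘ proj₂ (I≐J _) ,
    Sum.map (IsCone-cong I≐J) (Prod.map₂ (Dominates-cong I≐J)) legal ,
    IsResolution-cong as (colon-cong a I≐J) res

  core-cong : ∀ {I J : Ideal n} as → I ≐ J → core I as ≐ core J as
  core-cong [] I≐J = I≐J
  core-cong (a ∷ as) I≐J = core-cong as (colon-cong a I≐J)

  IsMaximalResolution-cong : ∀ {I J : Ideal n} {as} → I ≐ J →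
                             IsMaximalResolution I as → IsMaximalResolution J as
  IsMaximalResolution-cong {as = as} I≐J (res , max) =
    IsResolution-cong as I≐J res ,
    λ { (a , res′) → max (a , IsResolution-cong (as ++ [ a ]) (≐-sym I≐J) res′) }

  InCores-cong : ∀ {I J K : Ideal n} → I ≐ J → InCores I K → InCores J K
  InCores-cong I≐J (as , max , core≐K) =
    as , IsMaximalResolution-cong I≐J max , ≐-trans (core-cong as (≐-sym I≐J)) core≐K

  InCores-resp : ∀ {I K K′ : Ideal n} → InCores I K → K ≐ K′ → InCores I K′
  InCores-resp (as , max , core≐K) K≐K′ = as , max , ≐-trans core≐K K≐K′

  Terminal : Ideal n → Set
  Terminal I = ∀ a → ¬ IsResolution I [ a ]

  terminal-InCores : ∀ {I : Ideal n} → Terminal I → InCores I I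
  terminal-InCores term = [] , (tt , λ { (a , res) → term a res }) , ≐-refl

  InCores-terminal : ∀ {I K : Ideal n} → Terminal I → InCores I K → I ≐ K
  InCores-terminal term ([] , _ , I≐K) = I≐K
  InCores-terminal term (a ∷ _ , ((a∉I , legal , _) , _) , _) = ⊥-elim (term a (a∉I , legal , tt))

  InCores-∷ : ∀ {I K : Ideal n} {a} → IsResolution I [ a ] → InCores (colon I a) K → InCores I K
  InCores-∷ {a = a} (a∉I , legal , _) (as , (res , max) , core≐K) =
    a ∷ as , ((a∉I , legal , res) , λ { (b , _ , _ , res′) → max (b , res′) }) , core≐K

  InCores-uncons : ∀ {I K : Ideal n} {a₀} → IsResolution I [ a₀ ] → InCores I K →
                   ∃[ a ] (IsResolution I [ a ] × InCores (colon I a) K)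
  InCores-uncons res₀ ([] , (_ , max) , _) = ⊥-elim (max (_ , res₀))
  InCores-uncons res₀ (a ∷ as , ((a∉I , legal , res) , max) , core≐K) =
    a , (a∉I , legal , tt) , as , (res , λ { (b , res′) → max (b , a∉I , legal , res′) }) , core≐K

module EdgeIdealWithVariables {n} (G : Graph n) where

  edgeIdealWith : Subset n → Ideal n
  edgeIdealWith R S = (∃[ x ] (x ∈ R × x ∈ S)) ⊎ edgeIdeal G S

  edgeIdealWith-∅ : edgeIdealWith ∅ ≐ edgeIdeal G
  edgeIdealWith-∅ S = [ (λ { (_ , x∈∅ , _) → ⊥-elim (∉⊥ x∈∅) }) , id ]′ , inj₂

  edgeIdealWith-mono : ∀ {R R′ S} → R ⊆ R′ → edgeIdealWith R S → edgeIdealWith R′ S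
  edgeIdealWith-mono R⊆R′ = Sum.map₁ (Prod.map₂ (Prod.map₁ R⊆R′))

  edgeIdealWith-full : ∀ {R} → (∀ x → x ∈ R) → edgeIdealWith R ≐ maxIdeal
  edgeIdealWith-full all S =
    [ (λ { (x , _ , x∈S) → x , x∈S }) , (λ { (u , _ , _ , u∈S , _) → u , u∈S }) ]′ ,
    λ { (x , x∈S) → inj₁ (x , all x , x∈S) }

  neighbours : Fin n → Subset n
  neighbours a = Vec.tabulate (adj G a)

  ∈-neighbours⁺ : ∀ {a x} → Adj G a x → x ∈ neighbours a
  ∈-neighbours⁺ {a} {x} ax = lookup⇒[]= x (neighbours a) (trans (lookup∘tabulate (adj G a) x) ax)

  ∈-neighbours⁻ : ∀ {a x} → x ∈ neighbours a → Adj G a x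
  ∈-neighbours⁻ {a} {x} x∈ = trans (≡.sym (lookup∘tabulate (adj G a) x)) ([]=⇒lookup x∈)

  N[_] : Fin n → Subset n
  N[ a ] = ⁅ a ⁆ ∪ neighbours a

  ¬edgeIdeal-⁅⁆ : ∀ {v} → ¬ edgeIdeal G ⁅ v ⁆
  ¬edgeIdeal-⁅⁆ {v} (x , y , axy , x∈ , y∈) =
    Adj-irrefl G axy (trans (x∈⁅y⁆⇒x≡y v x∈) (≡.sym (x∈⁅y⁆⇒x≡y v y∈)))

  VarIn-edgeIdealWith : ∀ {R a} → VarIn (edgeIdealWith R) a → a ∈ R
  VarIn-edgeIdealWith {R} {a} (inj₁ (x , x∈R , x∈a)) = subst (_∈ R) (x∈⁅y⁆⇒x≡y a x∈a) x∈R
  VarIn-edgeIdealWith (inj₂ e) = ⊥-elim (¬edgeIdeal-⁅⁆ e)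

  colon-edgeIdealWith : ∀ {R a} → a ∉ R → colon (edgeIdealWith R) a ≐ edgeIdealWith (R ∪ N[ a ])
  colon-edgeIdealWith {R} {a} a∉R S = to , from
    where
      a∈⁅a⁆∪S : a ∈ ⁅ a ⁆ ∪ S
      a∈⁅a⁆∪S = x∈p∪q⁺ (inj₁ (x∈⁅x⁆ a))
      ∈⁅a⁆∪S : ∀ {x} → x ∈ S → x ∈ ⁅ a ⁆ ∪ S
      ∈⁅a⁆∪S x∈S = x∈p∪q⁺ (inj₂ x∈S)
      ∈R∪N : ∀ {x} → x ∈ N[ a ] → x ∈ R ∪ N[ a ]
      ∈R∪N x∈N = x∈p∪q⁺ (inj₂ x∈N)
      nbr : ∀ {u x} → u ∈ ⁅ a ⁆ → Adj G u x → x ∈ R ∪ N[ a ]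
      nbr u∈a aux =
        ∈R∪N (x∈p∪q⁺ (inj₂ (∈-neighbours⁺ (subst (λ t → Adj G t _) (x∈⁅y⁆⇒x≡y a u∈a) aux))))
      to : colon (edgeIdealWith R) a S → edgeIdealWith (R ∪ N[ a ]) S
      to (inj₁ a∈S) = inj₁ (a , ∈R∪N (x∈p∪q⁺ (inj₁ (x∈⁅x⁆ a))) , a∈S)
      to (inj₂ (inj₁ (x , x∈R , x∈aS))) with x∈p∪q⁻ ⁅ a ⁆ S x∈aS
      ... | inj₁ x∈a = ⊥-elim (a∉R (subst (_∈ R) (x∈⁅y⁆⇒x≡y a x∈a) x∈R))
      ... | inj₂ x∈S = inj₁ (x , x∈p∪q⁺ (inj₁ x∈R) , x∈S)
      to (inj₂ (inj₂ (u , v , auv , u∈ , v∈))) with x∈p∪q⁻ ⁅ a ⁆ S u∈ | x∈p∪q⁻ ⁅ a ⁆ S v∈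
      ... | inj₁ u∈a | inj₁ v∈a = ⊥-elim (¬edgeIdeal-⁅⁆ (u , v , auv , u∈a , v∈a))
      ... | inj₁ u∈a | inj₂ v∈S = inj₁ (v , nbr u∈a auv , v∈S)
      ... | inj₂ u∈S | inj₁ v∈a = inj₁ (u , nbr v∈a (Adj-sym G auv) , u∈S)
      ... | inj₂ u∈S | inj₂ v∈S = inj₂ (u , v , auv , u∈S , v∈S)
      from : edgeIdealWith (R ∪ N[ a ]) S → colon (edgeIdealWith R) a S
      from (inj₁ (x , x∈R∪N , x∈S)) with x∈p∪q⁻ R N[ a ] x∈R∪N
      ... | inj₁ x∈R = inj₂ (inj₁ (x , x∈R , ∈⁅a⁆∪S x∈S))
      ... | inj₂ x∈N with x∈p∪q⁻ ⁅ a ⁆ (neighbours a) x∈N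
      ...   | inj₁ x∈a = inj₁ (subst (_∈ S) (x∈⁅y⁆⇒x≡y a x∈a) x∈S)
      ...   | inj₂ x∈nb = inj₂ (inj₂ (a , x , ∈-neighbours⁻ x∈nb , a∈⁅a⁆∪S , ∈⁅a⁆∪S x∈S))
      from (inj₂ (u , v , auv , u∈S , v∈S)) = inj₂ (inj₂ (u , v , auv , ∈⁅a⁆∪S u∈S , ∈⁅a⁆∪S v∈S))

  addVar-edgeIdealWith : ∀ {R a} → addVar (edgeIdealWith R) a ≐ edgeIdealWith (R ∪ ⁅ a ⁆)
  addVar-edgeIdealWith {R} {a} S = to , from
    where
      to : addVar (edgeIdealWith R) a S → edgeIdealWith (R ∪ ⁅ a ⁆) S
      to (inj₁ a∈S) = inj₁ (a , x∈p∪q⁺ (inj₂ (x∈⁅x⁆ a)) , a∈S)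
      to (inj₂ x) = edgeIdealWith-mono (p⊆p∪q ⁅ a ⁆) x
      from : edgeIdealWith (R ∪ ⁅ a ⁆) S → addVar (edgeIdealWith R) a S
      from (inj₁ (x , x∈R∪a , x∈S)) with x∈p∪q⁻ R ⁅ a ⁆ x∈R∪a
      ... | inj₁ x∈R = inj₂ (inj₁ (x , x∈R , x∈S))
      ... | inj₂ x∈a = inj₁ (subst (_∈ S) (x∈⁅y⁆⇒x≡y a x∈a) x∈S)
      from (inj₂ e) = inj₂ (inj₂ e)

  Isolated : Subset n → Fin n → Set
  Isolated R b = b ∉ R × (∀ v → Adj G b v → v ∈ R)

  isolated? : ∀ R b → Dec (Isolated R b)
  isolated? R b = ¬? (b ∈? R) ×-dec all? (λ v → Adj? G b v →-dec v ∈? R)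

  Isolated⇒IsCone : ∀ {R b} → Isolated R b → IsCone (edgeIdealWith R) b
  Isolated⇒IsCone {R} {b} (b∉R , nbrs∈R) =
    ≐-trans (colon-edgeIdealWith b∉R)
      (≐-trans (λ S → edgeIdealWith-mono R∪N⊆R∪b , edgeIdealWith-mono R∪b⊆R∪N)
               (≐-sym addVar-edgeIdealWith))
    where
      R∪N⊆R∪b : R ∪ N[ b ] ⊆ R ∪ ⁅ b ⁆
      R∪N⊆R∪b x∈ with x∈p∪q⁻ R N[ b ] x∈
      ... | inj₁ x∈R = x∈p∪q⁺ (inj₁ x∈R)
      ... | inj₂ x∈N with x∈p∪q⁻ ⁅ b ⁆ (neighbours b) x∈N
      ...   | inj₁ x∈b = x∈p∪q⁺ (inj₂ x∈b)
      ...   | inj₂ x∈nb = x∈p∪q⁺ (inj₁ (nbrs∈R _ (∈-neighbours⁻ x∈nb)))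
      R∪b⊆R∪N : R ∪ ⁅ b ⁆ ⊆ R ∪ N[ b ]
      R∪b⊆R∪N x∈ = x∈p∪q⁺ (Sum.map₂ (λ x∈b → x∈p∪q⁺ (inj₁ x∈b)) (x∈p∪q⁻ R ⁅ b ⁆ x∈))

  IsCone⇒Isolated : ∀ {R b} → IsCone (edgeIdealWith R) b → Isolated R b
  IsCone⇒Isolated {R} {b} cone = b∉R , nbrs∈R
    where
      b∉R : b ∉ R
      b∉R b∈R with proj₁ (cone ∅) (inj₂ (inj₁ (b , b∈R , x∈p∪q⁺ (inj₁ (x∈⁅x⁆ b)))))
      ... | inj₁ b∈∅ = ∉⊥ b∈∅
      ... | inj₂ (inj₁ (_ , _ , x∈∅)) = ∉⊥ x∈∅
      ... | inj₂ (inj₂ (_ , _ , _ , u∈∅ , _)) = ∉⊥ u∈∅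
      nbrs∈R : ∀ v → Adj G b v → v ∈ R
      nbrs∈R v abv
        with proj₁ (cone ⁅ v ⁆) (inj₂ (inj₂ (b , v , abv , x∈p∪q⁺ (inj₁ (x∈⁅x⁆ b)) , x∈p∪q⁺ (inj₂ (x∈⁅x⁆ v)))))
      ... | inj₁ b∈v = ⊥-elim (Adj-irrefl G abv (x∈⁅y⁆⇒x≡y v b∈v))
      ... | inj₂ v∈I = VarIn-edgeIdealWith v∈I

  Dominates⁺ : ∀ {R a b} → ¬ Isolated R b → Isolated (R ∪ ⁅ a ⁆) b → Dominates (edgeIdealWith R) a b
  Dominates⁺ ¬iso iso′ =
    ¬iso ∘ IsCone⇒Isolated , IsCone-cong (≐-sym addVar-edgeIdealWith) (Isolated⇒IsCone iso′)

  dominates? : ∀ R a b → Dec (Dominates (edgeIdealWith R) a b)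
  dominates? R a b =
    map′ (λ { (¬iso , iso′) → Dominates⁺ ¬iso iso′ })
         (λ { (¬cone , cone′) →
                ¬cone ∘ Isolated⇒IsCone , IsCone⇒Isolated (IsCone-cong addVar-edgeIdealWith cone′) })
         (¬? (isolated? R b) ×-dec isolated? (R ∪ ⁅ a ⁆) b)

  step? : ∀ R a → Dec (IsResolution (edgeIdealWith R) [ a ])
  step? R a =
    map′ (λ { (a∉R , legal) → a∉R ∘ VarIn-edgeIdealWith , Sum.map₁ Isolated⇒IsCone legal , tt })
         (λ { (a∉I , legal , _) →
                a∉I ∘ (λ a∈R → inj₁ (a , a∈R , x∈⁅x⁆ a)) , Sum.map₁ IsCone⇒Isolated legal })
         (¬? (a ∈? R) ×-dec (isolated? R a ⊎-dec any? (dominates? R a)))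

  step-∉ : ∀ {R a} → IsResolution (edgeIdealWith R) [ a ] → a ∉ R
  step-∉ {a = a} (a∉I , _) a∈R = a∉I (inj₁ (a , a∈R , x∈⁅x⁆ a))

  step-colon : ∀ {R a} → IsResolution (edgeIdealWith R) [ a ] →
               colon (edgeIdealWith R) a ≐ edgeIdealWith (R ∪ N[ a ])
  step-colon = colon-edgeIdealWith ∘ step-∉

  step-⊂ : ∀ {R a} → IsResolution (edgeIdealWith R) [ a ] → R ⊂ R ∪ N[ a ]
  step-⊂ {R} {a} res = p⊆p∪q N[ a ] , a , x∈p∪q⁺ (inj₂ (x∈p∪q⁺ (inj₁ (x∈⁅x⁆ a)))) , step-∉ res

  terminal⇒minDegree≥2 : ∀ {R} → Terminal (edgeIdealWith R) → MinDegree≥2 G (∁ R)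
  terminal⇒minDegree≥2 {R} term = record { neighbour = neighbour ; anotherNeighbour = anotherNeighbour }
    where
      illegal : ∀ {a} → a ∉ R → ¬ (IsCone (edgeIdealWith R) a ⊎ ∃[ b ] Dominates (edgeIdealWith R) a b)
      illegal a∉R legal = term _ (a∉R ∘ VarIn-edgeIdealWith , legal , tt)

      neighbour : ∀ {w} → w ∈ ∁ R → ∃[ x ] (x ∈ ∁ R × Adj G w x)
      neighbour {w} w∈∁R with any? (λ x → x ∈? ∁ R ×-dec Adj? G w x)
      ... | yes found = found
      ... | no none = ⊥-elim (illegal w∉R (inj₁ (Isolated⇒IsCone (w∉R , nbrs∈R))))
        where
          w∉R = x∈∁p⇒x∉p w∈∁R
          nbrs∈R : ∀ v → Adj G w v → v ∈ R
          nbrs∈R v awv = decidable-stable (v ∈? R) λ v∉R → none (v , x∉p⇒x∈∁p v∉R , awv)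

      -- Otherwise x would dominate w.
      anotherNeighbour : ∀ {w x} → w ∈ ∁ R → x ∈ ∁ R → Adj G w x → ∃[ y ] (y ∈ ∁ R × Adj G w y × y ≢ x)
      anotherNeighbour {w} {x} w∈∁R x∈∁R awx
        with any? (λ y → y ∈? ∁ R ×-dec Adj? G w y ×-dec ¬? (y ≟ x))
      ... | yes found = found
      ... | no none =
        ⊥-elim (illegal x∉R (inj₂ (w , Dominates⁺ (λ iso → x∉R (proj₂ iso x awx)) (w∉R∪x , nbrs∈R∪x))))
        where
          x∉R = x∈∁p⇒x∉p x∈∁R
          w∉R∪x : w ∉ R ∪ ⁅ x ⁆
          w∉R∪x = [ x∈∁p⇒x∉p w∈∁R , Adj-irrefl G awx ∘ x∈⁅y⁆⇒x≡y x ]′ ∘ x∈p∪q⁻ R ⁅ x ⁆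
          nbrs∈R∪x : ∀ v → Adj G w v → v ∈ R ∪ ⁅ x ⁆
          nbrs∈R∪x v awv with v ≟ x | v ∈? R
          ... | yes refl | _ = x∈p∪q⁺ (inj₂ (x∈⁅x⁆ x))
          ... | no _ | yes v∈R = x∈p∪q⁺ (inj₁ v∈R)
          ... | no v≢x | no v∉R = ⊥-elim (none (v , x∉p⇒x∈∁p v∉R , awv , v≢x))

  InCores-nonempty : ∀ R → ∃[ K ] InCores (edgeIdealWith R) K
  InCores-nonempty R = go R (⊃-wellFounded R)
    where
      go : ∀ R → Acc _⊃_ R → ∃[ K ] InCores (edgeIdealWith R) K
      go R (acc more) with any? (step? R)
      ... | no none = edgeIdealWith R , terminal-InCores (λ a res → none (a , res))
      ... | yes (a , res) with go (R ∪ N[ a ]) (more (step-⊂ res))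
      ...   | K , inCores = K , InCores-∷ res (InCores-cong (≐-sym (step-colon res)) inCores)

  InCores⇒terminal-edgeIdealWith : ∀ {R K} → InCores (edgeIdealWith R) K →
                                   ∃[ Rf ] (K ≐ edgeIdealWith Rf × Terminal (edgeIdealWith Rf))
  InCores⇒terminal-edgeIdealWith {R} = go R (⊃-wellFounded R)
    where
      go : ∀ R {K} → Acc _⊃_ R → InCores (edgeIdealWith R) K →
           ∃[ Rf ] (K ≐ edgeIdealWith Rf × Terminal (edgeIdealWith Rf))
      go R (acc more) inCores with any? (step? R)
      ... | no none = R , ≐-sym (InCores-terminal term inCores) , term
        where
          term : Terminal (edgeIdealWith R)
          term a res = none (a , res)
      ... | yes (_ , res₀) with InCores-uncons res₀ inCores
      ...   | a , res , inCores′ = go (R ∪ N[ a ]) (more (step-⊂ res)) (InCores-cong (step-colon res) inCores′)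

  simple? : ∀ R → Dec (InCores (edgeIdealWith R) maxIdeal)
  simple? R = go R (⊃-wellFounded R)
    where
      go : ∀ R → Acc _⊃_ R → Dec (InCores (edgeIdealWith R) maxIdeal)
      go R (acc more) with any? (step? R)
      ... | no none =
        map′ (λ full → InCores-resp (terminal-InCores term) (edgeIdealWith-full full))
             (λ inCores x →
                VarIn-edgeIdealWith (proj₂ (InCores-terminal term inCores ⁅ x ⁆) (x , x∈⁅x⁆ x)))
             (all? (_∈? R))
        where
          term : Terminal (edgeIdealWith R)
          term a res = none (a , res)
      ... | yes (_ , res₀) =
        map′ (λ { (a , res , inCores) → InCores-∷ res (InCores-cong (≐-sym (step-colon res)) inCores) })
             (λ inCores → let a , res , inCores′ = InCores-uncons res₀ inCores
                          in a , res , InCores-cong (step-colon res) inCores′)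
             (any? simpleAfter)
        where
          simpleAfter : ∀ a → Dec (Σ (IsResolution (edgeIdealWith R) [ a ])
                                     λ _ → InCores (edgeIdealWith (R ∪ N[ a ])) maxIdeal)
          simpleAfter a with step? R a
          ... | yes res = map′ (res ,_) proj₂ (go (R ∪ N[ a ]) (more (step-⊂ res)))
          ... | no ¬res = no (¬res ∘ proj₁)

module UnicyclicCores {n} {G : Graph n} (h₁≡1 : H1isOne G) (C : Cycle G) where
  open Unicyclic h₁≡1 C
  open EdgeIdealWithVariables G

  edgeIdealWith-cycleIdeal : ∀ {R} → (∀ {u} → u ∉ R → OnCycle C u) → (∀ {u} → OnCycle C u → u ∉ R) →
                             edgeIdealWith R ≐ cycleIdeal C
  edgeIdealWith-cycleIdeal {R} ∉R⇒onC onC⇒∉R S = to , from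
    where
      to : edgeIdealWith R S → cycleIdeal C S
      to (inj₁ (x , x∈R , x∈S)) = inj₁ (x , x∈S , λ x∈C → onC⇒∉R x∈C x∈R)
      to (inj₂ (u , v , auv , u∈S , v∈S)) with u ∈? R | v ∈? R
      ... | yes u∈R | _ = inj₁ (u , u∈S , λ u∈C → onC⇒∉R u∈C u∈R)
      ... | no _ | yes v∈R = inj₁ (v , v∈S , λ v∈C → onC⇒∉R v∈C v∈R)
      ... | no u∉R | no v∉R = inj₂ (u , v , chordless (∉R⇒onC u∉R) (∉R⇒onC v∉R) auv , u∈S , v∈S)
      from : cycleIdeal C S → edgeIdealWith R S
      from (inj₁ (u , u∈S , u∉C)) = inj₁ (u , decidable-stable (u ∈? R) (u∉C ∘ ∉R⇒onC) , u∈S)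
      from (inj₂ (u , v , uv , u∈S , v∈S)) = inj₂ (u , v , CycEdge⇒Adj uv , u∈S , v∈S)

  terminal-cycleIdeal : ∀ {R} → Terminal (edgeIdealWith R) → ¬ (edgeIdealWith R ≐ maxIdeal) →
                        edgeIdealWith R ≐ cycleIdeal C
  terminal-cycleIdeal {R} term ¬max with ¬∀⟶∃¬ n (_∈ R) (_∈? R) (¬max ∘ edgeIdealWith-full)
  ... | w , w∉R = edgeIdealWith-cycleIdeal (minDegree≥2⊆cycle deg ∘ x∉p⇒x∈∁p)
                                           (x∈∁p⇒x∉p ∘ cycle⊆minDegree≥2 deg (x∉p⇒x∈∁p w∉R))
    where
      deg = terminal⇒minDegree≥2 term

proposition7p3 : (n : ℕ) (G : Graph n) → H1isOne G → (C : Cycle G) →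
    IsSimple (edgeIdeal G) ⊎ CoresSingleton (edgeIdeal G) (cycleIdeal C)
proposition7p3 n G h₁≡1 C = dichotomy (simple? ∅)
  where
    open EdgeIdealWithVariables G
    open UnicyclicCores h₁≡1 C

    coreIsCycle : ¬ InCores (edgeIdealWith ∅) maxIdeal →
                  ∀ {K} → InCores (edgeIdealWith ∅) K → K ≐ cycleIdeal C
    coreIsCycle ¬simple inCores with InCores⇒terminal-edgeIdealWith inCores
    ... | R , K≐ , term =
      ≐-trans K≐ (terminal-cycleIdeal term λ max → ¬simple (InCores-resp inCores (≐-trans K≐ max)))

    dichotomy : Dec (InCores (edgeIdealWith ∅) maxIdeal) →
                IsSimple (edgeIdeal G) ⊎ CoresSingleton (edgeIdeal G) (cycleIdeal C)
    dichotomy (yes simple) = inj₁ (InCores-cong edgeIdealWith-∅ simple)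
    dichotomy (no ¬simple) =
      inj₂ ( InCores-cong edgeIdealWith-∅ (InCores-resp inCores (coreIsCycle ¬simple inCores))
           , λ K → coreIsCycle ¬simple ∘ InCores-cong (≐-sym edgeIdealWith-∅) )
      where inCores = proj₂ (InCores-nonempty ∅)
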